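{- Let $C$ be an $X$-neighbour transitive code in $\Gamma=H(m,q)$ with minimum distance $\delta\geq 2$, such that for some $\alpha\in C$ the stabiliser $X_\alpha$ acts transitively on the set $\Gamma_1(\alpha)$ of vertices adjacent to $\alpha$. Then for every positive integer $p$, $\mathrm{Rep}_p(C)$ is $(X\times S_p)$-neighbour transitive in $H(mp,q)$.
   Context: $H(m,q)$ is the Hamming graph on $Q^m$, $|Q|=q$, adjacency = differing in exactly one entry. A code is a subset $C$ of vertices; minimum distance is the least Hamming distance between distinct codewords; $C_1$ is the set of non-codewords adjacent to some codeword; $C$ is $X$-neighbour transitive ($X$ a group of automorphisms) if $C$ and $C_1$ are $X$-orbits. Vertices of $H(mp,q)$ are identified with $p$-tuples $(\alpha_1,\ldots,\alpha_p)$ of vertices of $H(m,q)$ (concatenation), and $(x,\sigma)\in X\times S_p$ acts by $(\alpha_1,\ldots,\alpha_p)^{(x,\sigma)}=(\alpha^x_{1\sigma^{ -1}},\ldots,\alpha^x_{p\sigma^{ -1}})$. For $\alpha\in V(H(m,q))$, $\mathrm{rep}_p(\alpha)=(\alpha,\ldots,\alpha)$ and $\mathrm{Rep}_p(C)=\{\mathrm{rep}_p(\alpha):\alpha\in C\}$. -}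

module Defs where

open import Data.Nat using (ℕ; _*_; _≤_)
open import Data.Fin using (Fin)
open import Data.Fin.Properties using () renaming (_≟_ to _≟ᶠ_)
open import Data.Fin.Permutation using (Permutation′; _⟨$⟩ˡ_)
open import Data.Vec using (Vec; zipWith; count; concat; replicate; tabulate; lookup; group)
open import Data.Product using (Σ; ∃; _×_; _,_; proj₁)
open import Relation.Binary.PropositionalEquality using (_≡_)
open import Relation.Nullary using (¬_; ¬?)

-- Vertices of the Hamming graph H(m,q): words of length m over Q = Fin q.
V : ℕ → ℕ → Set
V m q = Vec (Fin q) m

dist : ∀ {m q} → V m q → V m q → ℕ
dist {m} {q} α β = count (λ (ab : Fin q × Fin q) → ¬? (proj₁ ab ≟ᶠ Data.Product.proj₂ ab))
                         (zipWith _,_ α β)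

Adj : ∀ {m q} → V m q → V m q → Set
Adj α β = dist α β ≡ 1

Code : ℕ → ℕ → Set₁
Code m q = V m q → Set

MinDistAtLeast : ∀ {m q} → Code m q → ℕ → Set
MinDistAtLeast C δ = ∀ α β → C α → C β → ¬ (α ≡ β) → δ ≤ dist α β

Neighbours : ∀ {m q} → Code m q → Code m q
Neighbours C β = ¬ C β × ∃ λ α → C α × Adj α β

record Aut (m q : ℕ) : Set where
  field
    to      : V m q → V m q
    from    : V m q → V m q
    to-from : ∀ α → to (from α) ≡ α
    from-to : ∀ α → from (to α) ≡ α
    adj→    : ∀ α β → Adj α β → Adj (to α) (to β)
    adj←    : ∀ α β → Adj (to α) (to β) → Adj α β
open Aut public

idAut : ∀ {m q} → Aut m q
idAut = record { to = λ a → a ; from = λ a → a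
               ; to-from = λ _ → Relation.Binary.PropositionalEquality.refl
               ; from-to = λ _ → Relation.Binary.PropositionalEquality.refl
               ; adj→ = λ _ _ h → h ; adj← = λ _ _ h → h }

_∘A_ : ∀ {m q} → Aut m q → Aut m q → Aut m q
f ∘A g = record
  { to = λ a → to g (to f a)          -- first f, then g (right actions)
  ; from = λ a → from f (from g a)
  ; to-from = λ a → Relation.Binary.PropositionalEquality.trans
                      (Relation.Binary.PropositionalEquality.cong (to g) (to-from f (from g a)))
                      (to-from g a)
  ; from-to = λ a → Relation.Binary.PropositionalEquality.trans
                      (Relation.Binary.PropositionalEquality.cong (from f) (from-to g (to f a)))
                      (from-to f a)
  ; adj→ = λ a b h → adj→ g _ _ (adj→ f a b h)
  ; adj← = λ a b h → adj← f a b (adj← g _ _ h) }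

invAut : ∀ {m q} → Aut m q → Aut m q
invAut f = record
  { to = from f ; from = to f ; to-from = from-to f ; from-to = to-from f
  ; adj→ = λ a b h → adj← f (from f a) (from f b)
             (Relation.Binary.PropositionalEquality.subst₂ Adj
               (Relation.Binary.PropositionalEquality.sym (to-from f a))
               (Relation.Binary.PropositionalEquality.sym (to-from f b)) h)
  ; adj← = λ a b h → Relation.Binary.PropositionalEquality.subst₂ Adj
             (to-from f a) (to-from f b) (adj→ f (from f a) (from f b) h) }

record IsAutGroup {m q : ℕ} (X : Aut m q → Set) : Set where
  field
    id-mem  : X idAut
    ∘-mem   : ∀ {f g} → X f → X g → X (f ∘A g)
    inv-mem : ∀ {f} → X f → X (invAut f)

IsOrbit : {G W : Set} → (G → Set) → (G → W → W) → (W → Set) → Set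
IsOrbit {G} {W} inG act S =
  (∃ λ w → S w)
  × (∀ g w → inG g → S w → S (act g w))
  × (∀ v w → S v → S w → Σ G λ g → inG g × act g v ≡ w)

NeighbourTransitive : ∀ {m q} {G : Set} → (G → Set) → (G → V m q → V m q) → Code m q → Set
NeighbourTransitive inG act C = IsOrbit inG act C × IsOrbit inG act (Neighbours C)

actX : ∀ {m q} → Aut m q → V m q → V m q
actX x α = to x α

StabTransitiveOnNbhd : ∀ {m q} → (Aut m q → Set) → V m q → Set
StabTransitiveOnNbhd X α =
  ∀ β γ → Adj α β → Adj α γ → Σ _ λ x → X x × to x α ≡ α × to x β ≡ γ

-- Vertices of H(mp,q) are concatenations of p vertices of H(m,q); we use the
-- length p * m (= mp) produced by Data.Vec.concat.
blocks : ∀ {m q} p → V (p * m) q → Vec (V m q) p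
blocks {m} p β = proj₁ (group p m β)

-- (x , σ) ∈ X × S_p acts by (α₁,…,α_p) ↦ (α^x_{1σ⁻¹}, …, α^x_{pσ⁻¹}).
actXSp : ∀ {m q p} → Aut m q × Permutation′ p → V (p * m) q → V (p * m) q
actXSp {p = p} (x , σ) β =
  concat (tabulate λ i → to x (lookup (blocks p β) (σ ⟨$⟩ˡ i)))

inXSp : ∀ {m q p} → (Aut m q → Set) → Aut m q × Permutation′ p → Set
inXSp X (x , σ) = X x

rep : ∀ {m q} p → V m q → V (p * m) q
rep p α = concat (replicate p α)

Rep : ∀ {m q} p → Code m q → Code (p * m) q
Rep p C β = ∃ λ α → C α × β ≡ rep p α

-- The neighbours of a repetition codeword rep_p(α) are exactly the words obtained by replacing
-- one block α by a neighbour α' of α; when δ ≥ 2 none of them lies in Rep_p(C).  So X × S_p is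
-- transitive on Rep_p(C)₁ as soon as X can move any arc (α, α') with α ∈ C to any other such
-- arc (which follows from the transitivity of X on C and of X_α on Γ₁(α)), with a transposition
-- of S_p moving the altered block to its place.
module Submission where

open import Defs
open import Data.Nat using (ℕ; zero; suc; _+_; _*_; _≤_)
open import Data.Nat.Properties using (suc-injective; +-identityʳ; 0≢1+n; <-irrefl)
open import Data.Fin using (Fin; zero; suc; _≟_)
open import Data.Fin.Permutation using (Permutation′; _⟨$⟩ˡ_; _⟨$⟩ʳ_; transpose; inverseˡ; inverseʳ) renaming (id to idₚ)
open import Data.Vec using (Vec; []; _∷_; _++_; concat; replicate; tabulate; lookup; _[_]≔_; group)
open import Data.Vec.Properties using (lookup-replicate; tabulate∘lookup; tabulate-cong; lookup∘update; lookup∘update′; ++-injective)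
open import Data.Product using (Σ; _×_; _,_; proj₂)
open import Data.Sum using (_⊎_; inj₁; inj₂)
open import Function using (_∘_)
open import Relation.Binary.PropositionalEquality
open import Relation.Nullary using (¬_; yes; no; contradiction)
open import Relation.Nullary.Decidable using (dec-true)

private
  variable
    m q p : ℕ

dist-self : (α : V m q) → dist α α ≡ 0
dist-self [] = refl
dist-self (a ∷ α) with a ≟ a
... | yes _ = dist-self α
... | no a≢a = contradiction refl a≢a

dist≡0⇒≡ : {α β : V m q} → dist α β ≡ 0 → α ≡ β
dist≡0⇒≡ {α = []} {[]} _ = refl
dist≡0⇒≡ {α = a ∷ α} {b ∷ β} eq with a ≟ b
... | yes a≡b = cong₂ _∷_ a≡b (dist≡0⇒≡ eq)

dist-++ : ∀ {k} (α γ : V k q) (β δ : V m q) → dist (α ++ β) (γ ++ δ) ≡ dist α γ + dist β δ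
dist-++ [] [] β δ = refl
dist-++ (a ∷ α) (c ∷ γ) β δ with a ≟ c
... | yes _ = dist-++ α γ β δ
... | no _ = cong suc (dist-++ α γ β δ)

Adj⇒≢ : {α β : V m q} → Adj α β → α ≢ β
Adj⇒≢ {α = α} adj refl = 0≢1+n (trans (sym (dist-self α)) adj)

minDist2⇒¬Adj : {C : Code m q} → MinDistAtLeast C 2 → ∀ {α β} → C α → C β → ¬ Adj α β
minDist2⇒¬Adj md {α} {β} Cα Cβ adj = <-irrefl refl (subst (2 ≤_) adj (md α β Cα Cβ (Adj⇒≢ adj)))

m+n≡1⇒ : ∀ m {n} → m + n ≡ 1 → (m ≡ 0 × n ≡ 1) ⊎ (m ≡ 1 × n ≡ 0)
m+n≡1⇒ zero eq = inj₁ (refl , eq)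
m+n≡1⇒ (suc zero) eq = inj₂ (refl , suc-injective eq)

tabulate-lookup : ∀ {n} {A : Set} {f : Fin n → A} (ys : Vec A n) → (∀ i → f i ≡ lookup ys i) → tabulate f ≡ ys
tabulate-lookup ys f≗ys = trans (tabulate-cong f≗ys) (tabulate∘lookup ys)

concat-injective : ∀ {n} {A : Set} (xss yss : Vec (Vec A m) n) → concat xss ≡ concat yss → xss ≡ yss
concat-injective [] [] _ = refl
concat-injective (xs ∷ xss) (ys ∷ yss) eq with ++-injective xs ys eq
... | xs≡ys , rest = cong₂ _∷_ xs≡ys (concat-injective xss yss rest)

blocks-concat : ∀ p (bs : Vec (V m q) p) → blocks p (concat bs) ≡ bs
blocks-concat {m} p bs = sym (concat-injective _ _ (proj₂ (group p m (concat bs))))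

concat-blocks : ∀ p (β : V (p * m) q) → concat (blocks p β) ≡ β
concat-blocks {m} p β = sym (proj₂ (group p m β))

transpose-sends : ∀ {n} (i j : Fin n) → transpose i j ⟨$⟩ʳ i ≡ j
transpose-sends i j rewrite dec-true (i ≟ i) refl = refl

repWith : ∀ p → V m q → Fin p → V m q → V (p * m) q
repWith p α i α' = concat (replicate p α [ i ]≔ α')

repWith≡rep⇒≡ : ∀ {α α' γ : V m q} {i : Fin p} → repWith p α i α' ≡ rep p γ → α' ≡ γ
repWith≡rep⇒≡ {p = p} {α} {α'} {γ} {i} eq = begin
  α'                                   ≡⟨ lookup∘update i (replicate p α) α' ⟨
  lookup (replicate p α [ i ]≔ α') i   ≡⟨ cong (λ bs → lookup bs i) replicate-≡ ⟩
  lookup (replicate p γ) i             ≡⟨ lookup-replicate i γ ⟩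
  γ                                    ∎
  where
  open ≡-Reasoning
  replicate-≡ : replicate p α [ i ]≔ α' ≡ replicate p γ
  replicate-≡ = concat-injective (replicate p α [ i ]≔ α') (replicate p γ) eq

dist-rep-repWith : ∀ p (α : V m q) i α' → dist (rep p α) (repWith p α i α') ≡ dist α α'
dist-rep-repWith (suc p) α zero α' =
  trans (dist-++ α α' _ _) (trans (cong (dist α α' +_) (dist-self (rep p α))) (+-identityʳ _))
dist-rep-repWith (suc p) α (suc i) α' =
  trans (dist-++ α α _ _) (cong₂ _+_ (dist-self α) (dist-rep-repWith p α i α'))

adj-rep-concat : ∀ p (α : V m q) (bs : Vec (V m q) p) → Adj (rep p α) (concat bs) →
  Σ (Fin p) λ i → Adj α (lookup bs i) × bs ≡ replicate p α [ i ]≔ lookup bs i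
adj-rep-concat (suc p) α (b ∷ bs) adj with m+n≡1⇒ (dist α b) (trans (sym (dist-++ α b _ _)) adj)
... | inj₁ (α≡b , rest-adj) with adj-rep-concat p α bs rest-adj
...   | i , α~bᵢ , bs≡ = suc i , α~bᵢ , cong₂ _∷_ (sym (dist≡0⇒≡ α≡b)) bs≡
adj-rep-concat (suc p) α (b ∷ bs) adj
    | inj₂ (α~b , rest≡) = zero , α~b , cong (b ∷_) (sym (concat-injective _ _ (dist≡0⇒≡ rest≡)))

actXSp-concat : ∀ (x : Aut m q) (σ : Permutation′ p) (bs : Vec (V m q) p) →
  actXSp (x , σ) (concat bs) ≡ concat (tabulate λ i → to x (lookup bs (σ ⟨$⟩ˡ i)))
actXSp-concat {p = p} x σ bs rewrite blocks-concat p bs = refl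

actXSp-rep : ∀ (x : Aut m q) (σ : Permutation′ p) α → actXSp (x , σ) (rep p α) ≡ rep p (to x α)
actXSp-rep {p = p} x σ α =
  trans (actXSp-concat x σ (replicate p α)) (cong concat (tabulate-lookup (replicate p (to x α)) block))
  where
  block : ∀ j → to x (lookup (replicate p α) (σ ⟨$⟩ˡ j)) ≡ lookup (replicate p (to x α)) j
  block j = trans (cong (to x) (lookup-replicate (σ ⟨$⟩ˡ j) α)) (sym (lookup-replicate j (to x α)))

actXSp-repWith : ∀ (x : Aut m q) (σ : Permutation′ p) α i α' →
  actXSp (x , σ) (repWith p α i α') ≡ repWith p (to x α) (σ ⟨$⟩ʳ i) (to x α')
actXSp-repWith {p = p} x σ α i α' =
  trans (actXSp-concat x σ (replicate p α [ i ]≔ α'))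
        (cong concat (tabulate-lookup (replicate p (to x α) [ σ ⟨$⟩ʳ i ]≔ to x α') block))
  where
  block : ∀ j → to x (lookup (replicate p α [ i ]≔ α') (σ ⟨$⟩ˡ j))
              ≡ lookup (replicate p (to x α) [ σ ⟨$⟩ʳ i ]≔ to x α') j
  block j with j ≟ σ ⟨$⟩ʳ i
  ... | yes refl = begin
    to x (lookup (replicate p α [ i ]≔ α') (σ ⟨$⟩ˡ (σ ⟨$⟩ʳ i)))  ≡⟨ cong (to x ∘ lookup (replicate p α [ i ]≔ α')) (inverseˡ σ) ⟩
    to x (lookup (replicate p α [ i ]≔ α') i)                   ≡⟨ cong (to x) (lookup∘update i (replicate p α) α') ⟩
    to x α'                                                     ≡⟨ lookup∘update (σ ⟨$⟩ʳ i) (replicate p (to x α)) (to x α') ⟨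
    lookup (replicate p (to x α) [ σ ⟨$⟩ʳ i ]≔ to x α') (σ ⟨$⟩ʳ i) ∎
    where open ≡-Reasoning
  ... | no j≢σi = begin
    to x (lookup (replicate p α [ i ]≔ α') (σ ⟨$⟩ˡ j))  ≡⟨ cong (to x) (lookup∘update′ σ⁻¹j≢i (replicate p α) α') ⟩
    to x (lookup (replicate p α) (σ ⟨$⟩ˡ j))            ≡⟨ cong (to x) (lookup-replicate (σ ⟨$⟩ˡ j) α) ⟩
    to x α                                              ≡⟨ lookup-replicate j (to x α) ⟨
    lookup (replicate p (to x α)) j                     ≡⟨ lookup∘update′ j≢σi (replicate p (to x α)) (to x α') ⟨
    lookup (replicate p (to x α) [ σ ⟨$⟩ʳ i ]≔ to x α') j ∎
    where
    open ≡-Reasoning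
    σ⁻¹j≢i : σ ⟨$⟩ˡ j ≢ i
    σ⁻¹j≢i eq = j≢σi (trans (sym (inverseʳ σ)) (cong (σ ⟨$⟩ʳ_) eq))

data RepNeighbour p (C : Code m q) : V (p * m) q → Set where
  neighbour : ∀ {α α'} (i : Fin p) → C α → Adj α α' → RepNeighbour p C (repWith p α i α')

Neighbours-Rep⇒RepNeighbour : ∀ p {C : Code m q} {β} → Neighbours (Rep p C) β → RepNeighbour p C β
Neighbours-Rep⇒RepNeighbour p {C} {β} (_ , _ , (α , Cα , refl) , adj)
  with adj-rep-concat p α (blocks p β) (subst (Adj (rep p α)) (sym (concat-blocks p β)) adj)
... | i , α~βᵢ , βs≡ =
  subst (RepNeighbour p C) (trans (cong concat (sym βs≡)) (concat-blocks p β)) (neighbour i Cα α~βᵢ)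

RepNeighbour⇒Neighbours-Rep : ∀ {p} {C : Code m q} → MinDistAtLeast C 2 →
  ∀ {β} → RepNeighbour p C β → Neighbours (Rep p C) β
RepNeighbour⇒Neighbours-Rep {p = p} {C} md (neighbour {α} {α'} i Cα α~α') =
  notRep , rep p α , (α , Cα , refl) , trans (dist-rep-repWith p α i α') α~α'
  where
  notRep : ¬ Rep p C (repWith p α i α')
  notRep (γ , Cγ , eq) = minDist2⇒¬Adj md Cα (subst C (sym (repWith≡rep⇒≡ {p = p} eq)) Cγ) α~α'

RepNeighbour-invariant : ∀ {X : Aut m q → Set} {C : Code m q} → (∀ x α → X x → C α → C (to x α)) →
  ∀ g {β} → inXSp {p = p} X g → RepNeighbour p C β → RepNeighbour p C (actXSp g β)
RepNeighbour-invariant {p = p} {C = C} invC (x , σ) Xx (neighbour {α} {α'} i Cα α~α') =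
  subst (RepNeighbour p C) (sym (actXSp-repWith x σ α i α'))
    (neighbour (σ ⟨$⟩ʳ i) (invC x α Xx Cα) (adj→ x α α' α~α'))

ArcTransitive : (Aut m q → Set) → Code m q → Set
ArcTransitive {m} {q} X C = ∀ {α₁ α₁' α₂ α₂'} → C α₁ → C α₂ → Adj α₁ α₁' → Adj α₂ α₂' →
  Σ (Aut m q) λ x → X x × to x α₁ ≡ α₂ × to x α₁' ≡ α₂'

stabTransitive⇒arcTransitive : ∀ {X : Aut m q → Set} {C : Code m q} → IsAutGroup X →
  (∀ α β → C α → C β → Σ (Aut m q) λ x → X x × to x α ≡ β) →
  (Σ (V m q) λ α₀ → C α₀ × StabTransitiveOnNbhd X α₀) → ArcTransitive X C
stabTransitive⇒arcTransitive grp transC (α₀ , Cα₀ , stab) {α₁} {α₁'} {α₂} {α₂'} Cα₁ Cα₂ α₁~α₁' α₂~α₂'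
  with transC α₁ α₀ Cα₁ Cα₀ | transC α₂ α₀ Cα₂ Cα₀
... | a , Xa , aα₁≡α₀ | b , Xb , bα₂≡α₀
  with stab (to a α₁') (to b α₂') (subst (λ z → Adj z (to a α₁')) aα₁≡α₀ (adj→ a α₁ α₁' α₁~α₁'))
                                  (subst (λ z → Adj z (to b α₂')) bα₂≡α₀ (adj→ b α₂ α₂' α₂~α₂'))
... | s , Xs , sα₀≡α₀ , saα₁'≡bα₂' =
  (a ∘A s) ∘A invAut b , ∘-mem (∘-mem Xa Xs) (inv-mem Xb) ,
  trans (cong (from b) (trans (cong (to s) aα₁≡α₀) (trans sα₀≡α₀ (sym bα₂≡α₀)))) (from-to b α₂) ,
  trans (cong (from b) saα₁'≡bα₂') (from-to b α₂')
  where open IsAutGroup grp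

RepNeighbour-transitive : ∀ {X : Aut m q → Set} {C : Code m q} → ArcTransitive X C →
  ∀ {β γ} → RepNeighbour p C β → RepNeighbour p C γ →
  Σ (Aut m q × Permutation′ p) λ g → inXSp X g × actXSp g β ≡ γ
RepNeighbour-transitive {p = p} arcs (neighbour {α₁} {α₁'} i Cα₁ α₁~α₁') (neighbour j Cα₂ α₂~α₂')
  with arcs Cα₁ Cα₂ α₁~α₁' α₂~α₂'
... | x , Xx , refl , refl =
  (x , transpose i j) , Xx ,
  trans (actXSp-repWith x (transpose i j) α₁ i α₁')
        (cong (λ k → repWith p (to x α₁) k (to x α₁')) (transpose-sends i j))

Rep-isOrbit : ∀ p {X : Aut m q → Set} {C : Code m q} →
  IsOrbit X actX C → IsOrbit (inXSp {p = p} X) actXSp (Rep p C)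
Rep-isOrbit {m} {q} p {X} {C} ((α , Cα) , invC , transC) = (rep p α , α , Cα , refl) , invariant , transitive
  where
  invariant : ∀ g β → inXSp X g → Rep p C β → Rep p C (actXSp g β)
  invariant (x , σ) _ Xx (α , Cα , refl) = to x α , invC x α Xx Cα , actXSp-rep {p = p} x σ α
  transitive : ∀ β γ → Rep p C β → Rep p C γ →
    Σ (Aut m q × Permutation′ p) λ g → inXSp X g × actXSp g β ≡ γ
  transitive _ _ (α , Cα , refl) (β , Cβ , refl) with transC α β Cα Cβ
  ... | x , Xx , refl = (x , idₚ) , Xx , actXSp-rep {p = p} x idₚ α

lemma2p8 : ∀ {m q : ℕ} (X : Aut m q → Set) (C : Code m q) →
    IsAutGroup X →
    NeighbourTransitive X actX C →
    MinDistAtLeast C 2 →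
    (Σ (V m q) λ α → C α × StabTransitiveOnNbhd X α) →
    ∀ (p : ℕ) → 1 ≤ p →
    NeighbourTransitive (inXSp {p = p} X) actXSp (Rep p C)
lemma2p8 {m} {q} X C grp (C-orbit@(_ , invC , transC) , (α' , _ , α , Cα , α~α') , _) md stab (suc p) _ =
  Rep-isOrbit (suc p) C-orbit , (nonempty , invariant , transitive)
  where
  arcs : ArcTransitive X C
  arcs = stabTransitive⇒arcTransitive grp transC stab
  toN : ∀ {β} → RepNeighbour (suc p) C β → Neighbours (Rep (suc p) C) β
  toN = RepNeighbour⇒Neighbours-Rep md
  fromN : ∀ {β} → Neighbours (Rep (suc p) C) β → RepNeighbour (suc p) C β
  fromN = Neighbours-Rep⇒RepNeighbour (suc p)
  nonempty : Σ (V (suc p * m) q) (Neighbours (Rep (suc p) C))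
  nonempty = repWith (suc p) α zero α' , toN (neighbour zero Cα α~α')
  invariant : ∀ g β → inXSp X g → Neighbours (Rep (suc p) C) β → Neighbours (Rep (suc p) C) (actXSp g β)
  invariant g β Xg Nβ = toN (RepNeighbour-invariant invC g Xg (fromN Nβ))
  transitive : ∀ β γ → Neighbours (Rep (suc p) C) β → Neighbours (Rep (suc p) C) γ →
    Σ (Aut m q × Permutation′ (suc p)) λ g → inXSp X g × actXSp g β ≡ γ
  transitive β γ Nβ Nγ = RepNeighbour-transitive arcs (fromN Nβ) (fromN Nγ)
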